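{- Let an instance be given as in the context, and let $x$ be a minimum cost assignment in which each demand $i$ is entirely assigned to exactly one FC, denoted $a(i)$ (so $x_{i,a(i)}=D_i$). Define the weighted directed graph $\mathcal G_x$ with vertex set $\{r\}\cup\mathcal F\cup\mathcal D$ and arcs: $(r,j)$ of weight $0$ for every $j\in\mathcal F$; $(j,i)$ of weight $-\ell_{ij}$ for every $i\in\mathcal D$ with $a(i)=j$; and $(i,j)$ of weight $\ell_{ij}$ for every $i\in\mathcal D$ and $j\in\mathcal F$ with $j\neq a(i)$. For every $j\in\mathcal F$ let $-\beta_j$ be the minimum weight of a directed path in $\mathcal G_x$ from $r$ to $j$, and for every $i\in\mathcal D$ let $-\delta_i$ be the minimum weight of a directed path from $r$ to $i$. Then these minimum weights are well defined, and the backlogs $\beta$ together with the assignment $x$ form a minimum-delay equilibrium solution whose delays are the $\delta_i$.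
   Context: An instance consists of finite disjoint sets $\mathcal D$ (demand nodes) and $\mathcal F$ (FCs), a metric $\ell$ on $\mathcal D\cup\mathcal F$ ($\ell_{ij}$ = distance between demand $i$ and FC $j$), demands $D_i>0$, capacities $C_j>0$, with $\sum_i D_i\le\sum_j C_j$. An assignment is $x\in\mathbb R_{\ge0}^{\mathcal D\times\mathcal F}$ with $\sum_j x_{ij}=D_i$ for all $i$ and $\sum_i x_{ij}\le C_j$ for all $j$; its cost is $\sum_{i,j}\ell_{ij}x_{ij}$; a minimum cost assignment minimizes cost. An equilibrium solution is a pair of backlogs $\beta_j\ge0$ and an assignment $x$ such that $x_{ij}>0$ only if $j\in\arg\min_{j'}(\ell_{ij'}+\beta_{j'})$, and every FC $j$ with $\sum_i x_{ij}<C_j$ has $\beta_j=0$. Its delays are $\delta_i=\min_j(\ell_{ij}+\beta_j)$ and its delay is $\sum_i D_i\delta_i$; a minimum-delay equilibrium solution is one of minimum delay among all equilibrium solutions.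
   Formalization: The metric ℓ, the demands $D_i$, the capacities $C_j$, the assignments and the backlogs, including those competing in minimum cost and minimum delay, are rational rather than real. -}

module Defs where

open import Data.Nat using (ℕ; zero; suc)
open import Data.Fin using (Fin; zero; suc)
open import Data.Sum using (_⊎_; inj₁; inj₂)
open import Data.Product using (Σ; _×_; _,_)
open import Data.List using (List; []; _∷_; _∷ʳ_)
open import Data.List.Relation.Unary.Unique.Propositional using (Unique)
open import Data.Rational using (ℚ; 0ℚ; _+_; _*_; -_; _≤_; _<_; _⊓_)
open import Relation.Binary.PropositionalEquality using (_≡_; _≢_)

sumF : {n : ℕ} → (Fin n → ℚ) → ℚ
sumF {zero}  f = 0ℚ
sumF {suc n} f = f zero + sumF (λ k → f (suc k))

-- Finite minimum over Fin n (value 0 on the empty index set, never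
-- relevant under the instance hypotheses).
minF : {n : ℕ} → (Fin n → ℚ) → ℚ
minF {zero}        f = 0ℚ
minF {suc zero}    f = f zero
minF {suc (suc n)} f = f zero ⊓ minF (λ k → f (suc k))

record IsMetric {X : Set} (d : X → X → ℚ) : Set where
  field
    nonneg   : ∀ u v → 0ℚ ≤ d u v
    zero-iff : ∀ u v → (d u v ≡ 0ℚ → u ≡ v) × (u ≡ v → d u v ≡ 0ℚ)
    symm     : ∀ u v → d u v ≡ d v u
    triangle : ∀ u v w → d u w ≤ d u v + d v w

record Instance : Set where
  field
    nD nF    : ℕ
    dist     : (Fin nD ⊎ Fin nF) → (Fin nD ⊎ Fin nF) → ℚ
    metric   : IsMetric dist
    Dem      : Fin nD → ℚ
    Cap      : Fin nF → ℚ
    Dem-pos  : ∀ i → 0ℚ < Dem i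
    Cap-pos  : ∀ j → 0ℚ < Cap j
    total    : sumF Dem ≤ sumF Cap

module _ (I : Instance) where
  open Instance I

  ℓ : Fin nD → Fin nF → ℚ
  ℓ i j = dist (inj₁ i) (inj₂ j)

  Assignment : Set
  Assignment = Fin nD → Fin nF → ℚ

  load : Assignment → Fin nF → ℚ
  load x j = sumF (λ i → x i j)

  IsAssignment : Assignment → Set
  IsAssignment x =
    (∀ i j → 0ℚ ≤ x i j) ×
    (∀ i → sumF (λ j → x i j) ≡ Dem i) ×
    (∀ j → load x j ≤ Cap j)

  cost : Assignment → ℚ
  cost x = sumF (λ i → sumF (λ j → ℓ i j * x i j))

  IsMinCostAssignment : Assignment → Set
  IsMinCostAssignment x =
    IsAssignment x × (∀ y → IsAssignment y → cost x ≤ cost y)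

  delayOf : (Fin nF → ℚ) → Fin nD → ℚ
  delayOf β i = minF (λ j → ℓ i j + β j)

  totalDelay : (Fin nF → ℚ) → ℚ
  totalDelay β = sumF (λ i → Dem i * delayOf β i)

  IsEquilibrium : (Fin nF → ℚ) → Assignment → Set
  IsEquilibrium β x =
    (∀ j → 0ℚ ≤ β j) ×
    IsAssignment x ×
    (∀ i j → 0ℚ < x i j → ∀ j' → ℓ i j + β j ≤ ℓ i j' + β j') ×
    (∀ j → load x j < Cap j → β j ≡ 0ℚ)

  IsMinDelayEquilibrium : (Fin nF → ℚ) → Assignment → Set
  IsMinDelayEquilibrium β x =
    IsEquilibrium β x ×
    (∀ β' x' → IsEquilibrium β' x' → totalDelay β ≤ totalDelay β')

  data Vtx : Set where
    root : Vtx
    fc   : Fin nF → Vtx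
    dm   : Fin nD → Vtx

  module Graph (a : Fin nD → Fin nF) where

    data Arc : Vtx → Vtx → Set where
      r→j : ∀ j → Arc root (fc j)
      j→i : ∀ i → Arc (fc (a i)) (dm i)
      i→j : ∀ i j → j ≢ a i → Arc (dm i) (fc j)

    arcWeight : ∀ {u v} → Arc u v → ℚ
    arcWeight (r→j j)     = 0ℚ
    arcWeight (j→i i)     = - ℓ i (a i)
    arcWeight (i→j i j _) = ℓ i j

    data Walk (u : Vtx) : Vtx → Set where
      stay : Walk u u
      step : ∀ {v w} → Walk u v → Arc v w → Walk u w

    vertices : ∀ {u v} → Walk u v → List Vtx
    vertices {u} stay  = u ∷ []
    vertices (step {w = w} p e) = vertices p ∷ʳ w

    weight : ∀ {u v} → Walk u v → ℚ
    weight stay       = 0ℚ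
    weight (step p e) = weight p + arcWeight e

    IsPath : ∀ {u v} → Walk u v → Set
    IsPath p = Unique (vertices p)

    IsMinPathWeight : Vtx → Vtx → ℚ → Set
    IsMinPathWeight u v m =
      Σ (Walk u v) (λ p → IsPath p × weight p ≡ m) ×
      (∀ (p : Walk u v) → IsPath p → m ≤ weight p)

{-# OPTIONS --safe #-}
-- A walk in G_x is read as a correction of x: an arc j → i withdraws a unit
-- of demand i from a(i), an arc i → j hands it to j, and the cost changes by
-- exactly the weight of the walk. A small multiple of the correction along a
-- closed walk, or along a walk from r to an FC with spare capacity, keeps x
-- feasible, so minimality of x makes the weights of these walks nonnegative.
-- Hence every walk can be shortcut to a path that is no heavier, minimum path
-- weights exist, and β_j = -dist(r, j) is an equilibrium with delays
-- -dist(r, i). For any other equilibrium (β', x'), the LP duality gap of x' is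
-- zero, so that of the min-cost x is zero too: x is complementary slack with
-- β', making -β' a potential bounding all walk weights. Thus β ≤ β', and the
-- total delay is monotone in the backlogs.
module Submission where

open import Defs
open import Algebra.Bundles using (Ring)
open import Data.Bool using (true; false; if_then_else_)
open import Data.Empty using (⊥-elim)
open import Data.Fin using (Fin; zero; suc)
open import Data.Fin.Properties using (_≟_)
open import Data.List using (List; []; _∷_; _++_; _∷ʳ_; length; map; concatMap; allFin)
open import Data.List.Membership.Propositional using (_∈_; _∉_)
open import Data.List.Membership.Propositional.Properties
  using (∈-++⁻; ∈-++⁺ˡ; ∈-++⁺ʳ; ∈-∃++; ∈-map⁺; ∈-allFin)
open import Data.List.Properties using (length-++)
open import Data.List.Relation.Binary.Subset.Propositional using (_⊆_)
open import Data.List.Relation.Unary.All as All using ([]; _∷_)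
import Data.List.Relation.Unary.All.Properties as AllP
open import Data.List.Relation.Unary.AllPairs using ([]; _∷_)
open import Data.List.Relation.Unary.Any as Any using (Any; here; there)
import Data.List.Relation.Unary.Any.Properties as AnyP
open import Data.List.Relation.Unary.Unique.Propositional using (Unique)
import Data.List.Relation.Unary.Unique.Propositional.Properties as UniqueP
open import Data.Nat as ℕ using (ℕ)
import Data.Nat.Properties as ℕP
open import Data.Product using (Σ; _×_; _,_; proj₁; proj₂)
open import Data.Rational using (ℚ; 0ℚ; 1ℚ; _+_; _*_; -_; _-_; _≤_; _<_; 1/_; positive; nonNegative)
open import Data.Rational.Properties hiding (_≟_)
open import Data.Rational.Solver using (module +-*-Solver)
open import Data.Sum using (inj₁; inj₂)
open import Function using (_∘_; id)
open import Relation.Binary.Bundles using (DecTotalOrder)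
open import Relation.Binary.Definitions using (DecidableEquality)
open import Relation.Binary.PropositionalEquality
open import Relation.Nullary using (Dec; yes; no; does)
open import Relation.Nullary.Decidable using (dec-false; map′)

open import Algebra.Properties.Group +-0-group using (⁻¹-involutive)
open import Algebra.Properties.Semiring.Sum (Ring.semiring +-*-ring)
  using (sum; sum-cong-≗; sum-replicate-zero; ∑-distrib-+; ∑-comm; *-distribˡ-sum)
open import Data.List.Extrema (DecTotalOrder.totalOrder ≤-decTotalOrder) using (argmin; f[argmin]≤v⁺)
open +-*-Solver

private variable
  n : ℕ
  p q r s : ℚ

p≤q⇒0≤q-p : p ≤ q → 0ℚ ≤ q - p
p≤q⇒0≤q-p {p} {q} p≤q = subst (_≤ q - p) (+-inverseʳ p) (+-monoˡ-≤ (- p) p≤q)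

p<q⇒0<q-p : p < q → 0ℚ < q - p
p<q⇒0<q-p {p} {q} p<q = subst (_< q - p) (+-inverseʳ p) (+-monoˡ-< (- p) p<q)

0≤q-p⇒p≤q : 0ℚ ≤ q - p → p ≤ q
0≤q-p⇒p≤q {q} {p} 0≤q-p =
  subst₂ _≤_ (+-identityˡ p) (solve 2 (λ q p → (q :- p) :+ p := q) refl q p) (+-monoˡ-≤ p 0≤q-p)

-- Moves an inequality to any other with the same slack, so that linear
-- steps reduce to ring identities for the solver.
≤-by-slack : p ≤ q → q - p ≡ s - r → r ≤ s
≤-by-slack p≤q eq = 0≤q-p⇒p≤q (subst (0ℚ ≤_) eq (p≤q⇒0≤q-p p≤q))

0≤p+q : 0ℚ ≤ p → 0ℚ ≤ q → 0ℚ ≤ p + q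
0≤p+q {p} {q} 0≤p 0≤q = subst (_≤ p + q) (+-identityˡ 0ℚ) (+-mono-≤ 0≤p 0≤q)

0≤p*q : 0ℚ ≤ p → 0ℚ ≤ q → 0ℚ ≤ p * q
0≤p*q {p} {q} 0≤p 0≤q =
  nonNegative⁻¹ (p * q) {{nonNeg*nonNeg⇒nonNeg p {{nonNegative 0≤p}} q {{nonNegative 0≤q}}}}

0<p*q : 0ℚ < p → 0ℚ < q → 0ℚ < p * q
0<p*q {p} {q} 0<p 0<q = positive⁻¹ (p * q) {{pos*pos⇒pos p {{positive 0<p}} q {{positive 0<q}}}}

p≤p+q : 0ℚ ≤ q → p ≤ p + q
p≤p+q {q} {p} 0≤q = subst (_≤ p + q) (+-identityʳ p) (+-monoʳ-≤ p 0≤q)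

p≤q+p : 0ℚ ≤ q → p ≤ q + p
p≤q+p {q} {p} 0≤q = subst (_≤ q + p) (+-identityˡ p) (+-monoˡ-≤ p 0≤q)

∃-small-scale : 0ℚ ≤ q → 0ℚ < s → Σ ℚ λ ε → 0ℚ < ε × ε ≤ s × ε * q ≤ s
∃-small-scale {q} {s} 0≤q 0<s = ε , 0<ε , ε≤s , εq≤s
  where
  0<1+q : 0ℚ < 1ℚ + q
  0<1+q = <-≤-trans (positive⁻¹ 1ℚ) (p≤p+q 0≤q)
  instance
    1+q-positive = positive 0<1+q
    1+q-nonZero = pos⇒nonZero (1ℚ + q)
  ε : ℚ
  ε = s * 1/ (1ℚ + q)
  0<ε : 0ℚ < ε
  0<ε = 0<p*q 0<s (positive⁻¹ _ {{1/pos⇒pos (1ℚ + q)}})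
  ε[1+q]≡s : ε * (1ℚ + q) ≡ s
  ε[1+q]≡s = trans (*-assoc s _ _) (trans (cong (s *_) (*-inverseˡ (1ℚ + q))) (*-identityʳ s))
  s-ε≡εq : s - ε ≡ ε * q
  s-ε≡εq = subst (λ t → t - ε ≡ ε * q) ε[1+q]≡s
             (solve 2 (λ e q → e :* (con 1ℚ :+ q) :- e := e :* q) refl ε q)
  s-εq≡ε : s - ε * q ≡ ε
  s-εq≡ε = subst (λ t → t - ε * q ≡ ε) ε[1+q]≡s
             (solve 2 (λ e q → e :* (con 1ℚ :+ q) :- e :* q := e) refl ε q)
  ε≤s : ε ≤ s
  ε≤s = 0≤q-p⇒p≤q (subst (0ℚ ≤_) (sym s-ε≡εq) (0≤p*q (<⇒≤ 0<ε) 0≤q))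
  εq≤s : ε * q ≤ s
  εq≤s = 0≤q-p⇒p≤q (subst (0ℚ ≤_) (sym s-εq≡ε) (<⇒≤ 0<ε))

sumF≡sum : (f : Fin n → ℚ) → sumF f ≡ sum f
sumF≡sum {ℕ.zero}  f = refl
sumF≡sum {ℕ.suc n} f = cong (f zero +_) (sumF≡sum (λ k → f (suc k)))

sumF-cong : {f g : Fin n → ℚ} → (∀ k → f k ≡ g k) → sumF f ≡ sumF g
sumF-cong {f = f} {g} f≗g = trans (sumF≡sum f) (trans (sum-cong-≗ f≗g) (sym (sumF≡sum g)))

sumF-zero : sumF {n} (λ _ → 0ℚ) ≡ 0ℚ
sumF-zero {n} = trans (sumF≡sum {n} (λ _ → 0ℚ)) (sum-replicate-zero n)

sumF-+ : (f g : Fin n → ℚ) → sumF (λ k → f k + g k) ≡ sumF f + sumF g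
sumF-+ f g = trans (sumF≡sum (λ k → f k + g k))
                   (trans (∑-distrib-+ f g) (sym (cong₂ _+_ (sumF≡sum f) (sumF≡sum g))))

*-distribˡ-sumF : ∀ c (f : Fin n → ℚ) → c * sumF f ≡ sumF (λ k → c * f k)
*-distribˡ-sumF c f = trans (cong (c *_) (sumF≡sum f))
                            (trans (*-distribˡ-sum c f) (sym (sumF≡sum (λ k → c * f k))))

sumF-comm : ∀ {m} (f : Fin m → Fin n → ℚ) →
            sumF (λ i → sumF (λ j → f i j)) ≡ sumF (λ j → sumF (λ i → f i j))
sumF-comm f = begin
  sumF (λ i → sumF (f i))          ≡⟨ trans (sumF≡sum (λ i → sumF (f i))) (sum-cong-≗ (λ i → sumF≡sum (f i))) ⟩
  sum (λ i → sum (f i))            ≡⟨ ∑-comm f ⟩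
  sum (λ j → sum (λ i → f i j))    ≡⟨ sym (trans (sumF≡sum fᵀ) (sum-cong-≗ (λ j → sumF≡sum (λ i → f i j)))) ⟩
  sumF fᵀ                          ∎
  where
  open ≡-Reasoning
  fᵀ = λ j → sumF (λ i → f i j)

sumF-neg : (f : Fin n → ℚ) → sumF (λ k → - f k) ≡ - sumF f
sumF-neg {ℕ.zero}  f = refl
sumF-neg {ℕ.suc n} f = trans (cong (- f zero +_) (sumF-neg (λ k → f (suc k)))) (sym (neg-distrib-+ (f zero) _))

sumF-− : (f g : Fin n → ℚ) → sumF (λ k → f k - g k) ≡ sumF f - sumF g
sumF-− f g = trans (sumF-+ f (λ k → - g k)) (cong (sumF f +_) (sumF-neg g))

sumF-+-*ˡ : ∀ c (f g : Fin n → ℚ) → sumF (λ k → f k + c * g k) ≡ sumF f + c * sumF g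
sumF-+-*ˡ c f g = trans (sumF-+ f (λ k → c * g k)) (cong (sumF f +_) (sym (*-distribˡ-sumF c g)))

sumF-mono-≤ : {f g : Fin n → ℚ} → (∀ k → f k ≤ g k) → sumF f ≤ sumF g
sumF-mono-≤ {ℕ.zero}  f≤g = ≤-refl
sumF-mono-≤ {ℕ.suc n} f≤g = +-mono-≤ (f≤g zero) (sumF-mono-≤ (λ k → f≤g (suc k)))

sumF-nonNeg : {f : Fin n → ℚ} → (∀ k → 0ℚ ≤ f k) → 0ℚ ≤ sumF f
sumF-nonNeg {n} {f} 0≤f = subst (_≤ sumF f) (sumF-zero {n}) (sumF-mono-≤ 0≤f)

≤-sumF : {f : Fin n → ℚ} → (∀ k → 0ℚ ≤ f k) → ∀ k → f k ≤ sumF f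
≤-sumF 0≤f zero    = p≤p+q (sumF-nonNeg (λ k → 0≤f (suc k)))
≤-sumF 0≤f (suc k) = ≤-trans (≤-sumF (λ k → 0≤f (suc k)) k) (p≤q+p (0≤f zero))

≤-sumF₂ : {f : Fin n → ℚ} → (∀ k → 0ℚ ≤ f k) → ∀ {j k} → j ≢ k → f j + f k ≤ sumF f
≤-sumF₂ 0≤f {zero}  {zero}  j≢k = ⊥-elim (j≢k refl)
≤-sumF₂ {f = f} 0≤f {zero}  {suc k} j≢k = +-monoʳ-≤ (f zero) (≤-sumF (λ k → 0≤f (suc k)) k)
≤-sumF₂ {f = f} 0≤f {suc j} {zero}  j≢k =
  subst (_≤ sumF f) (+-comm (f zero) (f (suc j))) (+-monoʳ-≤ (f zero) (≤-sumF (λ k → 0≤f (suc k)) j))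
≤-sumF₂ 0≤f {suc j} {suc k} j≢k =
  ≤-trans (≤-sumF₂ (λ k → 0≤f (suc k)) (j≢k ∘ cong suc)) (p≤q+p (0≤f zero))

kronecker : Fin n → Fin n → ℚ
kronecker k l = if does (k ≟ l) then 1ℚ else 0ℚ

kronecker-≢ : {k l : Fin n} → k ≢ l → kronecker k l ≡ 0ℚ
kronecker-≢ {k = k} {l} k≢l rewrite dec-false (k ≟ l) k≢l = refl

0≤kronecker : (k l : Fin n) → 0ℚ ≤ kronecker k l
0≤kronecker k l with does (k ≟ l)
... | true  = nonNegative⁻¹ 1ℚ
... | false = ≤-refl

kronecker≤1 : (k l : Fin n) → kronecker k l ≤ 1ℚ
kronecker≤1 k l with does (k ≟ l)
... | true  = ≤-refl
... | false = nonNegative⁻¹ 1ℚ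

sumF-kronecker : (k : Fin n) (g : Fin n → ℚ) → sumF (λ l → kronecker k l * g l) ≡ g k
sumF-kronecker {ℕ.suc n} zero g = begin
  1ℚ * g zero + sumF (λ l → 0ℚ * g (suc l))
    ≡⟨ cong₂ _+_ (*-identityˡ (g zero)) (sumF-cong (λ l → *-zeroˡ (g (suc l)))) ⟩
  g zero + sumF {n} (λ _ → 0ℚ)
    ≡⟨ trans (cong (g zero +_) (sumF-zero {n})) (+-identityʳ (g zero)) ⟩
  g zero ∎
  where open ≡-Reasoning
sumF-kronecker (suc k) g =
  trans (cong (_+ rest) (*-zeroˡ (g zero))) (trans (+-identityˡ rest) (sumF-kronecker k (g ∘ suc)))
  where rest = sumF (λ l → kronecker k l * g (suc l))

minF-≤ : (f : Fin n → ℚ) (k : Fin n) → minF f ≤ f k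
minF-≤ {ℕ.suc ℕ.zero}    f zero    = ≤-refl
minF-≤ {ℕ.suc (ℕ.suc n)} f zero    = p⊓q≤p (f zero) _
minF-≤ {ℕ.suc (ℕ.suc n)} f (suc k) = ≤-trans (p⊓q≤q (f zero) _) (minF-≤ (f ∘ suc) k)

minF-greatest : {f : Fin n → ℚ} → Fin n → (∀ k → q ≤ f k) → q ≤ minF f
minF-greatest {ℕ.suc ℕ.zero}    _ q≤f = q≤f zero
minF-greatest {ℕ.suc (ℕ.suc n)} _ q≤f = ⊓-glb (q≤f zero) (minF-greatest zero (q≤f ∘ suc))

minF-attained : {f : Fin n → ℚ} (k : Fin n) → (∀ j → f k ≤ f j) → minF f ≡ f k
minF-attained {f = f} k fk≤f = ≤-antisym (minF-≤ f k) (minF-greatest k fk≤f)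

minF-mono-≤ : {f g : Fin n → ℚ} → (∀ k → f k ≤ g k) → minF f ≤ minF g
minF-mono-≤ {ℕ.zero}          _   = ≤-refl
minF-mono-≤ {ℕ.suc ℕ.zero}    f≤g = f≤g zero
minF-mono-≤ {ℕ.suc (ℕ.suc n)} f≤g = ⊓-mono-≤ (f≤g zero) (minF-mono-≤ (f≤g ∘ suc))

∃-positive-lowerBound : {f : Fin n → ℚ} → (∀ k → 0ℚ < f k) → 0ℚ < s →
                        Σ ℚ λ t → 0ℚ < t × t ≤ s × (∀ k → t ≤ f k)
∃-positive-lowerBound {ℕ.zero} {s = s} _ 0<s = s , 0<s , ≤-refl , λ ()
∃-positive-lowerBound {ℕ.suc n} {f = f} 0<f 0<s
  with t , 0<t , t≤s , t≤f ← ∃-positive-lowerBound (0<f ∘ suc) 0<s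
     | f zero ≤? t
... | yes f₀≤t = f zero , 0<f zero , ≤-trans f₀≤t t≤s ,
                 λ { zero → ≤-refl ; (suc k) → ≤-trans f₀≤t (t≤f k) }
... | no  f₀≰t = t , 0<t , t≤s , λ { zero → <⇒≤ (≰⇒> f₀≰t) ; (suc k) → t≤f k }

module _ {A : Set} where

  Unique-++⁻ˡ : (xs : List A) {ys : List A} → Unique (xs ++ ys) → Unique xs
  Unique-++⁻ˡ []       _              = []
  Unique-++⁻ˡ (x ∷ xs) (x∉xs++ys ∷ u) = AllP.++⁻ˡ xs x∉xs++ys ∷ Unique-++⁻ˡ xs u

  Unique-∷ʳ : {xs : List A} {y : A} → Unique xs → y ∉ xs → Unique (xs ∷ʳ y)
  Unique-∷ʳ u y∉xs = UniqueP.++⁺ u ([] ∷ []) λ { (y∈xs , here refl) → y∉xs y∈xs }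

  Unique-⊆⇒length≤ : {xs ys : List A} → Unique xs → xs ⊆ ys → length xs ℕ.≤ length ys
  Unique-⊆⇒length≤ {[]}     _              _     = ℕ.z≤n
  Unique-⊆⇒length≤ {x ∷ xs} {ys} (x∉xs ∷ u) x∷xs⊆ys
    with us , vs , refl ← ∈-∃++ (x∷xs⊆ys (here refl)) = begin
      ℕ.suc (length xs)               ≤⟨ ℕ.s≤s (Unique-⊆⇒length≤ u xs⊆us++vs) ⟩
      ℕ.suc (length (us ++ vs))       ≡⟨ cong ℕ.suc (length-++ us) ⟩
      ℕ.suc (length us ℕ.+ length vs) ≡⟨ sym (ℕP.+-suc (length us) (length vs)) ⟩
      length us ℕ.+ length (x ∷ vs)   ≡⟨ sym (length-++ us) ⟩
      length (us ++ x ∷ vs)           ∎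
    where
    open ℕP.≤-Reasoning
    xs⊆us++vs : xs ⊆ us ++ vs
    xs⊆us++vs z∈xs with ∈-++⁻ us (x∷xs⊆ys (there z∈xs))
    ... | inj₁ z∈us         = ∈-++⁺ˡ z∈us
    ... | inj₂ (here refl)  = ⊥-elim (All.lookup x∉xs z∈xs refl)
    ... | inj₂ (there z∈vs) = ∈-++⁺ʳ us z∈vs

module _ (I : Instance) where
  open Instance I

  costRow : Assignment I → Fin nD → ℚ
  costRow g i = sumF (λ j → ℓ I i j * g i j)

  cost-zero : cost I (λ _ _ → 0ℚ) ≡ 0ℚ
  cost-zero = trans (sumF-cong (λ i → trans (sumF-cong (λ j → *-zeroʳ (ℓ I i j))) (sumF-zero {nF})))
                    (sumF-zero {nD})

  cost-+ : (g h : Assignment I) → cost I (λ i j → g i j + h i j) ≡ cost I g + cost I h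
  cost-+ g h = trans (sumF-cong row) (sumF-+ (costRow g) (costRow h))
    where
    row : ∀ i → sumF (λ j → ℓ I i j * (g i j + h i j)) ≡ costRow g i + costRow h i
    row i = trans (sumF-cong (λ j → *-distribˡ-+ (ℓ I i j) (g i j) (h i j)))
              (sumF-+ (λ j → ℓ I i j * g i j) (λ j → ℓ I i j * h i j))

  cost-neg : (g : Assignment I) → cost I (λ i j → - g i j) ≡ - cost I g
  cost-neg g = trans (sumF-cong row) (sumF-neg (costRow g))
    where
    row : ∀ i → sumF (λ j → ℓ I i j * - g i j) ≡ - costRow g i
    row i = trans (sumF-cong (λ j → sym (neg-distribʳ-* (ℓ I i j) (g i j))))
              (sumF-neg (λ j → ℓ I i j * g i j))

  cost-*ˡ : ∀ c (g : Assignment I) → cost I (λ i j → c * g i j) ≡ c * cost I g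
  cost-*ˡ c g = sym (trans (*-distribˡ-sumF c (costRow g)) (sumF-cong row))
    where
    row : ∀ i → c * costRow g i ≡ sumF (λ j → ℓ I i j * (c * g i j))
    row i = trans (*-distribˡ-sumF c (λ j → ℓ I i j * g i j))
              (sumF-cong (λ j → solve 3 (λ c l x → c :* (l :* x) := l :* (c :* x)) refl c (ℓ I i j) (g i j)))

  unitFlow : Fin nD → Fin nF → Assignment I
  unitFlow i₀ j₀ i j = kronecker i₀ i * kronecker j₀ j

  cost-unitFlow : ∀ i₀ j₀ → cost I (unitFlow i₀ j₀) ≡ ℓ I i₀ j₀
  cost-unitFlow i₀ j₀ = begin
    sumF (λ i → sumF (λ j → ℓ I i j * (kronecker i₀ i * kronecker j₀ j)))
      ≡⟨ sumF-cong (λ i → sumF-cong (λ j →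
           solve 3 (λ l a b → l :* (a :* b) := a :* (b :* l)) refl (ℓ I i j) (kronecker i₀ i) (kronecker j₀ j))) ⟩
    sumF (λ i → sumF (λ j → kronecker i₀ i * (kronecker j₀ j * ℓ I i j)))
      ≡⟨ sumF-cong (λ i → sym (*-distribˡ-sumF (kronecker i₀ i) (λ j → kronecker j₀ j * ℓ I i j))) ⟩
    sumF (λ i → kronecker i₀ i * sumF (λ j → kronecker j₀ j * ℓ I i j))
      ≡⟨ sumF-cong (λ i → cong (kronecker i₀ i *_) (sumF-kronecker j₀ (ℓ I i))) ⟩
    sumF (λ i → kronecker i₀ i * ℓ I i j₀)
      ≡⟨ sumF-kronecker i₀ (λ i → ℓ I i j₀) ⟩
    ℓ I i₀ j₀ ∎
    where open ≡-Reasoning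

  sumF-unitFlow : ∀ i₀ j₀ i → sumF (unitFlow i₀ j₀ i) ≡ kronecker i₀ i
  sumF-unitFlow i₀ j₀ i = trans (sumF-cong (λ j → *-comm (kronecker i₀ i) (kronecker j₀ j)))
                                (sumF-kronecker j₀ (λ _ → kronecker i₀ i))

  load-unitFlow : ∀ i₀ j₀ j → load I (unitFlow i₀ j₀) j ≡ kronecker j₀ j
  load-unitFlow i₀ j₀ j = sumF-kronecker i₀ (λ _ → kronecker j₀ j)

  0≤unitFlow : ∀ i₀ j₀ i j → 0ℚ ≤ unitFlow i₀ j₀ i j
  0≤unitFlow i₀ j₀ i j = 0≤p*q (0≤kronecker i₀ i) (0≤kronecker j₀ j)

  unitFlow≤1 : ∀ i₀ j₀ i j → unitFlow i₀ j₀ i j ≤ 1ℚ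
  unitFlow≤1 i₀ j₀ i j = ≤-trans
    (subst (unitFlow i₀ j₀ i j ≤_) (*-identityʳ (kronecker i₀ i))
      (*-monoˡ-≤-nonNeg (kronecker i₀ i) {{nonNegative (0≤kronecker i₀ i)}} (kronecker≤1 j₀ j)))
    (kronecker≤1 i₀ i)

  module Walks (a : Fin nD → Fin nF) where
    open Graph I a

    private variable
      u v w : Vtx I

    demandMass : Vtx I → Fin nD → ℚ
    demandMass (dm i₀) i = kronecker i₀ i
    demandMass _       _ = 0ℚ

    fcMass : Vtx I → Fin nF → ℚ
    fcMass (fc j₀) j = kronecker j₀ j
    fcMass _       _ = 0ℚ

    arcFlow : Arc u v → Assignment I
    arcFlow (r→j _)       _ _ = 0ℚ
    arcFlow (j→i i₀)      i j = - unitFlow i₀ (a i₀) i j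
    arcFlow (i→j i₀ j₀ _) i j = unitFlow i₀ j₀ i j

    flow : Walk u v → Assignment I
    flow stay       _ _ = 0ℚ
    flow (step p e) i j = flow p i j + arcFlow e i j

    cost-arcFlow : (e : Arc u v) → cost I (arcFlow e) ≡ arcWeight e
    cost-arcFlow (r→j _)       = cost-zero
    cost-arcFlow (j→i i₀)      = trans (cost-neg (unitFlow i₀ (a i₀))) (cong -_ (cost-unitFlow i₀ (a i₀)))
    cost-arcFlow (i→j i₀ j₀ _) = cost-unitFlow i₀ j₀

    cost-flow : (p : Walk u v) → cost I (flow p) ≡ weight p
    cost-flow stay       = cost-zero
    cost-flow (step p e) = trans (cost-+ (flow p) (arcFlow e)) (cong₂ _+_ (cost-flow p) (cost-arcFlow e))

    sumF-arcFlow : (e : Arc u v) → ∀ i → sumF (λ j → arcFlow e i j) ≡ demandMass u i - demandMass v i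
    sumF-arcFlow (r→j _)       i = sumF-zero {nF}
    sumF-arcFlow (j→i i₀)      i = trans (sumF-neg (unitFlow i₀ (a i₀) i))
                                     (trans (cong -_ (sumF-unitFlow i₀ (a i₀) i)) (sym (+-identityˡ _)))
    sumF-arcFlow (i→j i₀ j₀ _) i = trans (sumF-unitFlow i₀ j₀ i) (sym (+-identityʳ _))

    sumF-flow : (p : Walk u v) → ∀ i → sumF (λ j → flow p i j) ≡ demandMass u i - demandMass v i
    sumF-flow {u} stay       i = trans (sumF-zero {nF}) (sym (+-inverseʳ (demandMass u i)))
    sumF-flow {u} (step {w} {v} p e) i = begin
      sumF (λ j → flow p i j + arcFlow e i j)
        ≡⟨ sumF-+ (flow p i) (arcFlow e i) ⟩
      sumF (flow p i) + sumF (arcFlow e i)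
        ≡⟨ cong₂ _+_ (sumF-flow p i) (sumF-arcFlow e i) ⟩
      (demandMass u i - demandMass w i) + (demandMass w i - demandMass v i)
        ≡⟨ solve 3 (λ x y z → (x :- y) :+ (y :- z) := x :- z) refl (demandMass u i) (demandMass w i) (demandMass v i) ⟩
      demandMass u i - demandMass v i ∎
      where open ≡-Reasoning

    load-arcFlow : (e : Arc u v) → ∀ j → load I (arcFlow e) j ≤ fcMass v j - fcMass u j
    load-arcFlow (r→j j₀)      j = subst₂ _≤_ (sym (sumF-zero {nD})) (sym (+-identityʳ _)) (0≤kronecker j₀ j)
    load-arcFlow (j→i i₀)      j = ≤-reflexive (trans (sumF-neg (λ i → unitFlow i₀ (a i₀) i j))
                                     (trans (cong -_ (load-unitFlow i₀ (a i₀) j)) (sym (+-identityˡ _))))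
    load-arcFlow (i→j i₀ j₀ _) j = ≤-reflexive (trans (load-unitFlow i₀ j₀ j) (sym (+-identityʳ _)))

    load-flow : (p : Walk u v) → ∀ j → load I (flow p) j ≤ fcMass v j - fcMass u j
    load-flow {u} stay j = ≤-reflexive (trans (sumF-zero {nD}) (sym (+-inverseʳ (fcMass u j))))
    load-flow {u} (step {w} {v} p e) j = begin
      sumF (λ i → flow p i j + arcFlow e i j)
        ≡⟨ sumF-+ (λ i → flow p i j) (λ i → arcFlow e i j) ⟩
      load I (flow p) j + load I (arcFlow e) j
        ≤⟨ +-mono-≤ (load-flow p j) (load-arcFlow e j) ⟩
      (fcMass w j - fcMass u j) + (fcMass v j - fcMass w j)
        ≡⟨ solve 3 (λ x y z → (y :- x) :+ (z :- y) := z :- x) refl (fcMass u j) (fcMass w j) (fcMass v j) ⟩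
      fcMass v j - fcMass u j ∎
      where open ≤-Reasoning

    lengthℚ : Walk u v → ℚ
    lengthℚ stay       = 0ℚ
    lengthℚ (step p _) = lengthℚ p + 1ℚ

    0≤lengthℚ : (p : Walk u v) → 0ℚ ≤ lengthℚ p
    0≤lengthℚ stay       = ≤-refl
    0≤lengthℚ (step p _) = 0≤p+q (0≤lengthℚ p) (nonNegative⁻¹ 1ℚ)

    -1≤arcFlow : (e : Arc u v) → ∀ i j → - 1ℚ ≤ arcFlow e i j
    -1≤arcFlow (r→j _)       i j = neg-antimono-≤ (nonNegative⁻¹ 1ℚ)
    -1≤arcFlow (j→i i₀)      i j = neg-antimono-≤ (unitFlow≤1 i₀ (a i₀) i j)
    -1≤arcFlow (i→j i₀ j₀ _) i j = ≤-trans (neg-antimono-≤ (nonNegative⁻¹ 1ℚ)) (0≤unitFlow i₀ j₀ i j)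

    -lengthℚ≤flow : (p : Walk u v) → ∀ i j → - lengthℚ p ≤ flow p i j
    -lengthℚ≤flow stay       i j = ≤-refl
    -lengthℚ≤flow (step p e) i j =
      subst (_≤ flow p i j + arcFlow e i j) (sym (neg-distrib-+ (lengthℚ p) 1ℚ))
            (+-mono-≤ (-lengthℚ≤flow p i j) (-1≤arcFlow e i j))

    unitFlow-≢ : ∀ i₀ {i j} → j ≢ a i → unitFlow i₀ (a i₀) i j ≡ 0ℚ
    unitFlow-≢ i₀ {i} {j} j≢aᵢ with i₀ ≟ i
    ... | yes refl = trans (*-identityˡ _) (kronecker-≢ (j≢aᵢ ∘ sym))
    ... | no _     = *-zeroˡ (kronecker (a i₀) j)

    0≤arcFlow-≢ : (e : Arc u v) → ∀ {i j} → j ≢ a i → 0ℚ ≤ arcFlow e i j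
    0≤arcFlow-≢ (r→j _)       j≢aᵢ = ≤-refl
    0≤arcFlow-≢ (j→i i₀)      j≢aᵢ = ≤-reflexive (sym (cong -_ (unitFlow-≢ i₀ j≢aᵢ)))
    0≤arcFlow-≢ (i→j i₀ j₀ _) j≢aᵢ = 0≤unitFlow i₀ j₀ _ _

    0≤flow-≢ : (p : Walk u v) → ∀ {i j} → j ≢ a i → 0ℚ ≤ flow p i j
    0≤flow-≢ stay       j≢aᵢ = ≤-refl
    0≤flow-≢ (step p e) j≢aᵢ = 0≤p+q (0≤flow-≢ p j≢aᵢ) (0≤arcFlow-≢ e j≢aᵢ)

    potential : (Fin nF → ℚ) → Vtx I → ℚ
    potential β root   = 0ℚ
    potential β (fc j) = - β j
    potential β (dm i) = - β (a i) - ℓ I i (a i)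

    potential-≤-weight : {β : Fin nF → ℚ} → (∀ j → 0ℚ ≤ β j) →
                         (∀ i j → ℓ I i (a i) + β (a i) ≤ ℓ I i j + β j) →
                         (p : Walk root v) → potential β v ≤ weight p
    potential-≤-weight 0≤β _ stay = ≤-refl
    potential-≤-weight 0≤β aᵢ-opt (step p (r→j j)) =
      ≤-trans (neg-antimono-≤ (0≤β j)) (+-monoˡ-≤ 0ℚ (potential-≤-weight 0≤β aᵢ-opt p))
    potential-≤-weight 0≤β aᵢ-opt (step p (j→i i)) =
      +-monoˡ-≤ (- ℓ I i (a i)) (potential-≤-weight 0≤β aᵢ-opt p)
    potential-≤-weight {β = β} 0≤β aᵢ-opt (step p (i→j i j _)) =
      ≤-trans (≤-by-slack (aᵢ-opt i j)
                (solve 4 (λ la ba l b → (l :+ b) :- (la :+ ba) := ((:- ba :- la) :+ l) :- (:- b)) refl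
                  (ℓ I i (a i)) (β (a i)) (ℓ I i j) (β j)))
              (+-monoˡ-≤ (ℓ I i j) (potential-≤-weight 0≤β aᵢ-opt p))

    _≟ⱽ_ : DecidableEquality (Vtx I)
    root ≟ⱽ root  = yes refl
    root ≟ⱽ fc _  = no λ ()
    root ≟ⱽ dm _  = no λ ()
    fc _ ≟ⱽ root  = no λ ()
    fc j ≟ⱽ fc j′ = map′ (cong fc) (λ { refl → refl }) (j ≟ j′)
    fc _ ≟ⱽ dm _  = no λ ()
    dm _ ≟ⱽ root  = no λ ()
    dm _ ≟ⱽ fc _  = no λ ()
    dm i ≟ⱽ dm i′ = map′ (cong dm) (λ { refl → refl }) (i ≟ i′)

    splitAt : (p : Walk u v) → w ∈ vertices p →
              Σ (Walk u w) λ p₁ → Σ (Walk w v) λ p₂ →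
                weight p ≡ weight p₁ + weight p₂ × (IsPath p → IsPath p₁)
    splitAt stay (here refl) = stay , stay , sym (+-identityˡ 0ℚ) , id
    splitAt (step p e) w∈p′ with ∈-++⁻ (vertices p) w∈p′
    ... | inj₂ (here refl) = step p e , stay , sym (+-identityʳ _) , id
    ... | inj₁ w∈p with p₁ , p₂ , weight≡ , p₁-path ← splitAt p w∈p =
      p₁ , step p₂ e ,
      trans (cong (_+ arcWeight e) weight≡) (+-assoc (weight p₁) (weight p₂) (arcWeight e)) ,
      p₁-path ∘ Unique-++⁻ˡ (vertices p)

    shortcut : (∀ {w} (c : Walk w w) → 0ℚ ≤ weight c) →
               (p : Walk u v) → Σ (Walk u v) λ q → IsPath q × weight q ≤ weight p
    shortcut _ stay = stay , [] ∷ [] , ≤-refl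
    shortcut {v = v} 0≤cycle (step p e)
      with q , q-path , q≤p ← shortcut 0≤cycle p | Any.any? (v ≟ⱽ_) (vertices q)
    ... | no v∉q  = step q e , Unique-∷ʳ q-path v∉q , +-monoˡ-≤ (arcWeight e) q≤p
    ... | yes v∈q with q₁ , q₂ , weight≡ , q₁-path ← splitAt q v∈q = q₁ , q₁-path q-path , (begin
      weight q₁                              ≤⟨ p≤p+q (0≤cycle (step q₂ e)) ⟩
      weight q₁ + (weight q₂ + arcWeight e)  ≡⟨ sym (trans (cong (_+ arcWeight e) weight≡)
                                                           (+-assoc (weight q₁) (weight q₂) (arcWeight e))) ⟩
      weight q + arcWeight e                 ≤⟨ +-monoˡ-≤ (arcWeight e) q≤p ⟩
      weight p + arcWeight e                 ∎)
      where open ≤-Reasoning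

    allVertices : List (Vtx I)
    allVertices = root ∷ map fc (allFin nF) ++ map dm (allFin nD)

    ∈-allVertices : ∀ v → v ∈ allVertices
    ∈-allVertices root   = here refl
    ∈-allVertices (fc j) = there (∈-++⁺ˡ (∈-map⁺ fc (∈-allFin j)))
    ∈-allVertices (dm i) = there (∈-++⁺ʳ (map fc (allFin nF)) (∈-map⁺ dm (∈-allFin i)))

    length-vertices-step : (p : Walk u v) (e : Arc v w) →
                           length (vertices (step p e)) ≡ ℕ.suc (length (vertices p))
    length-vertices-step p e = trans (length-++ (vertices p)) (ℕP.+-comm _ 1)

    length-vertices≤ : (p : Walk u v) → IsPath p → length (vertices p) ℕ.≤ length allVertices
    length-vertices≤ p p-path = Unique-⊆⇒length≤ p-path (λ {z} _ → ∈-allVertices z)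

    viaDemand : ∀ {i} j → Dec (j ≡ a i) → List (Walk root (dm i)) → List (Walk root (fc j))
    viaDemand j (yes _)    _  = []
    viaDemand j (no j≢aᵢ) ps = map (λ p → step p (i→j _ j j≢aᵢ)) ps

    viaDemandWithin : ℕ → ∀ j i → List (Walk root (fc j))
    walksWithin : ℕ → (v : Vtx I) → List (Walk root v)
    walksWithin _         root   = stay ∷ []
    walksWithin ℕ.zero    (fc j) = []
    walksWithin ℕ.zero    (dm i) = []
    walksWithin (ℕ.suc n) (fc j) =
      map (λ p → step p (r→j j)) (walksWithin n root) ++ concatMap (viaDemandWithin n j) (allFin nD)
    walksWithin (ℕ.suc n) (dm i) = map (λ p → step p (j→i i)) (walksWithin n (fc (a i)))

    viaDemandWithin n j i = viaDemand j (j ≟ a i) (walksWithin n (dm i))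

    -- Walks are only enumerated up to weight: an i→j arc carries a proof of
    -- j ≢ a i, a function, so two walks cannot be shown equal.
    private
      HasWeight : ℚ → Walk root v → Set
      HasWeight c p = weight p ≡ c

    walksWithin-step : ∀ {n} {p : Walk root u} (e : Arc u v) →
                       Any (HasWeight (weight p)) (walksWithin n u) →
                       Any (HasWeight (weight (step p e))) (walksWithin (ℕ.suc n) v)
    walksWithin-step (r→j j) p∈ =
      AnyP.++⁺ˡ (AnyP.map⁺ {f = λ q → step q (r→j j)} (Any.map (cong (_+ 0ℚ)) p∈))
    walksWithin-step (j→i i) p∈ = AnyP.map⁺ (Any.map (cong (_+ - ℓ I i (a i))) p∈)
    walksWithin-step {n = n} {p} (i→j i j j≢aᵢ) p∈ =
      AnyP.++⁺ʳ (map (λ p → step p (r→j j)) (walksWithin n root))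
        (AnyP.concatMap⁺ (viaDemandWithin n j) (Any.map (λ { refl → via (j ≟ a i) }) (∈-allFin i)))
      where
      via : (d : Dec (j ≡ a i)) → Any (HasWeight (weight p + ℓ I i j)) (viaDemand j d (walksWithin n (dm i)))
      via (yes j≡aᵢ) = ⊥-elim (j≢aᵢ j≡aᵢ)
      via (no _)     = AnyP.map⁺ (Any.map (cong (_+ ℓ I i j)) p∈)

    walksWithin-complete : ∀ {n} (p : Walk root v) → length (vertices p) ℕ.≤ n →
                           Any (HasWeight (weight p)) (walksWithin n v)
    walksWithin-complete stay _ = here refl
    walksWithin-complete {n = n} (step p e) len≤n
      with ℕ.s≤s len≤n′ ← subst (ℕ._≤ n) (length-vertices-step p e) len≤n =
      walksWithin-step {p = p} e (walksWithin-complete p len≤n′)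

    defaultWalk : (v : Vtx I) → Walk root v
    defaultWalk root   = stay
    defaultWalk (fc j) = step stay (r→j j)
    defaultWalk (dm i) = step (defaultWalk (fc (a i))) (j→i i)

    -- Opaque: unfolding the enumeration in conversion checks is prohibitively slow.
    opaque
      lightestCandidate : (v : Vtx I) → Walk root v
      lightestCandidate v = argmin weight (defaultWalk v) (walksWithin (length allVertices) v)

      lightestCandidate-≤-path : (p : Walk root v) → IsPath p → weight (lightestCandidate v) ≤ weight p
      lightestCandidate-≤-path p p-path = f[argmin]≤v⁺ _ _
        (inj₂ (Any.map ≤-reflexive (walksWithin-complete p (length-vertices≤ p p-path))))

  reducedCost : (Fin nF → ℚ) → Fin nD → Fin nF → ℚ
  reducedCost β i j = (ℓ I i j + β j) - delayOf I β i

  0≤reducedCost : ∀ β i j → 0ℚ ≤ reducedCost β i j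
  0≤reducedCost β i j = p≤q⇒0≤q-p (minF-≤ (λ j → ℓ I i j + β j) j)

  -- Duality gap of the transportation LP at the dual point (delayOf β, β);
  -- its terms vanish exactly under complementary slackness.
  dualGap : (Fin nF → ℚ) → Assignment I → ℚ
  dualGap β y = sumF (λ i → sumF (λ j → reducedCost β i j * y i j)) + sumF (λ j → β j * (Cap j - load I y j))

  dualObjective : (Fin nF → ℚ) → ℚ
  dualObjective β = totalDelay I β - sumF (λ j → β j * Cap j)

  dualGap≡ : ∀ β {y} → IsAssignment I y → dualGap β y ≡ cost I y - dualObjective β
  dualGap≡ β {y} (_ , y-rows , _) = begin
    sumF (λ i → sumF (λ j → reducedCost β i j * y i j)) + sumF (λ j → β j * (Cap j - load I y j))
      ≡⟨ cong₂ _+_ (sumF-cong rowᵢ) (sumF-cong (λ j → *-distribˡ-+ (β j) (Cap j) (- load I y j))) ⟩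
    sumF (λ i → (costRow y i + βy i) - Dem i * δ i) + sumF (λ j → β j * Cap j + β j * - load I y j)
      ≡⟨ cong₂ _+_ (trans (sumF-− (λ i → costRow y i + βy i) (λ i → Dem i * δ i))
                          (cong (_- totalDelay I β) (sumF-+ (costRow y) βy)))
                   (trans (sumF-+ (λ j → β j * Cap j) (λ j → β j * - load I y j))
                          (cong (βC +_) (sumF-cong (λ j → sym (neg-distribʳ-* (β j) (load I y j)))))) ⟩
    (cost I y + sumF βy - totalDelay I β) + (βC + sumF (λ j → - (β j * load I y j)))
      ≡⟨ cong₂ (λ s t → (cost I y + s - totalDelay I β) + (βC + t)) βload (sumF-neg (λ j → β j * load I y j)) ⟩
    (cost I y + βL - totalDelay I β) + (βC - βL)
      ≡⟨ solve 4 (λ c l d b → (c :+ l :- d) :+ (b :- l) := c :- (d :- b)) refl (cost I y) βL (totalDelay I β) βC ⟩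
    cost I y - dualObjective β ∎
    where
    open ≡-Reasoning
    δ = delayOf I β
    βC = sumF (λ j → β j * Cap j)
    βL = sumF (λ j → β j * load I y j)
    βy : Fin nD → ℚ
    βy i = sumF (λ j → β j * y i j)
    rowᵢ : ∀ i → sumF (λ j → reducedCost β i j * y i j) ≡ (costRow y i + βy i) - Dem i * δ i
    rowᵢ i = begin
      sumF (λ j → reducedCost β i j * y i j)
        ≡⟨ sumF-cong (λ j → solve 4 (λ l b d x → ((l :+ b) :- d) :* x := (l :* x :+ b :* x) :- d :* x)
                              refl (ℓ I i j) (β j) (δ i) (y i j)) ⟩
      sumF (λ j → (ℓ I i j * y i j + β j * y i j) - δ i * y i j)
        ≡⟨ sumF-− (λ j → ℓ I i j * y i j + β j * y i j) (λ j → δ i * y i j) ⟩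
      sumF (λ j → ℓ I i j * y i j + β j * y i j) - sumF (λ j → δ i * y i j)
        ≡⟨ cong₂ _-_ (sumF-+ (λ j → ℓ I i j * y i j) (λ j → β j * y i j))
                     (trans (sym (*-distribˡ-sumF (δ i) (y i)))
                            (trans (cong (δ i *_) (y-rows i)) (*-comm (δ i) (Dem i)))) ⟩
      (costRow y i + βy i) - Dem i * δ i ∎
    βload : sumF βy ≡ βL
    βload = trans (sumF-comm (λ i j → β j * y i j)) (sumF-cong (λ j → sym (*-distribˡ-sumF (β j) (λ i → y i j))))

  dualGap-equilibrium : ∀ {β x′} → IsEquilibrium I β x′ → dualGap β x′ ≡ 0ℚ
  dualGap-equilibrium {β} {x′} (_ , (0≤x′ , _ , x′-cap) , x′-opt , x′-spare) =
    trans (cong₂ _+_ (trans (sumF-cong (λ i → trans (sumF-cong (term≡0 i)) (sumF-zero {nF}))) (sumF-zero {nD}))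
                     (trans (sumF-cong slack≡0) (sumF-zero {nF})))
          (+-identityˡ 0ℚ)
    where
    term≡0 : ∀ i j → reducedCost β i j * x′ i j ≡ 0ℚ
    term≡0 i j with 0ℚ <? x′ i j
    ... | yes 0<x′ = trans (cong (_* x′ i j) tight) (*-zeroˡ (x′ i j))
      where
      tight : reducedCost β i j ≡ 0ℚ
      tight = trans (cong (λ d → (ℓ I i j + β j) - d) (minF-attained j (x′-opt i j 0<x′)))
                    (+-inverseʳ (ℓ I i j + β j))
    ... | no 0≮x′ = trans (cong (reducedCost β i j *_) (≤-antisym (≮⇒≥ 0≮x′) (0≤x′ i j)))
                          (*-zeroʳ (reducedCost β i j))
    slack≡0 : ∀ j → β j * (Cap j - load I x′ j) ≡ 0ℚ
    slack≡0 j with load I x′ j <? Cap j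
    ... | yes under = trans (cong (_* (Cap j - load I x′ j)) (x′-spare j under)) (*-zeroˡ (Cap j - load I x′ j))
    ... | no  full  = trans (cong (λ c → β j * (c - load I x′ j)) (≤-antisym (≮⇒≥ full) (x′-cap j)))
                            (trans (cong (β j *_) (+-inverseʳ (load I x′ j))) (*-zeroʳ (β j)))

  reducedCost-≤-dualGap : ∀ {β y} → (∀ j → 0ℚ ≤ β j) → IsAssignment I y →
                          ∀ i j → reducedCost β i j * y i j ≤ dualGap β y
  reducedCost-≤-dualGap {β} {y} 0≤β (0≤y , _ , y-cap) i j = begin
    reducedCost β i j * y i j                            ≤⟨ ≤-sumF 0≤termᵢ j ⟩
    sumF (λ j → reducedCost β i j * y i j)               ≤⟨ ≤-sumF (λ i → sumF-nonNeg (0≤termᵢ {i})) i ⟩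
    sumF (λ i → sumF (λ j → reducedCost β i j * y i j))  ≤⟨ p≤p+q (sumF-nonNeg 0≤slack) ⟩
    dualGap β y                                          ∎
    where
    open ≤-Reasoning
    0≤termᵢ : ∀ {i} j → 0ℚ ≤ reducedCost β i j * y i j
    0≤termᵢ {i} j = 0≤p*q (0≤reducedCost β i j) (0≤y i j)
    0≤slack : ∀ j → 0ℚ ≤ β j * (Cap j - load I y j)
    0≤slack j = 0≤p*q (0≤β j) (p≤q⇒0≤q-p (y-cap j))

  minCost-tight : ∀ {β x′ x} → IsEquilibrium I β x′ → IsMinCostAssignment I x →
                  ∀ i j → 0ℚ < x i j → ℓ I i j + β j ≤ delayOf I β i
  minCost-tight {β} {x′} {x} eq@(0≤β , x′-asg , _) (x-asg , x-min) i j 0<x =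
    ≤-by-slack reducedCost≤0
      (solve 2 (λ c d → con 0ℚ :- (c :- d) := d :- c) refl (ℓ I i j + β j) (delayOf I β i))
    where
    open ≤-Reasoning
    term≤0 : reducedCost β i j * x i j ≤ 0ℚ * x i j
    term≤0 = begin
      reducedCost β i j * x i j    ≤⟨ reducedCost-≤-dualGap 0≤β x-asg i j ⟩
      dualGap β x                  ≡⟨ dualGap≡ β x-asg ⟩
      cost I x - dualObjective β   ≤⟨ +-monoˡ-≤ (- dualObjective β) (x-min x′ x′-asg) ⟩
      cost I x′ - dualObjective β  ≡⟨ sym (dualGap≡ β x′-asg) ⟩
      dualGap β x′                 ≡⟨ dualGap-equilibrium eq ⟩
      0ℚ                           ≡⟨ sym (*-zeroˡ (x i j)) ⟩
      0ℚ * x i j                   ∎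
    reducedCost≤0 : reducedCost β i j ≤ 0ℚ
    reducedCost≤0 = *-cancelʳ-≤-pos (x i j) {{positive 0<x}} term≤0

  totalDelay-mono-≤ : ∀ {β β′} → (∀ j → β j ≤ β′ j) → totalDelay I β ≤ totalDelay I β′
  totalDelay-mono-≤ β≤β′ = sumF-mono-≤ (λ i →
    *-monoˡ-≤-nonNeg (Dem i) {{nonNegative (<⇒≤ (Dem-pos i))}}
      (minF-mono-≤ (λ j → +-monoʳ-≤ (ℓ I i j) (β≤β′ j))))

  ∃-stepSize : ∀ {L b} → 0ℚ ≤ L → 0ℚ < b → Σ ℚ λ ε → 0ℚ < ε × ε ≤ b × (∀ i → ε * L ≤ Dem i)
  ∃-stepSize 0≤L 0<b =
    let t , 0<t , t≤b , t≤Dem = ∃-positive-lowerBound Dem-pos 0<b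
        ε , 0<ε , ε≤t , εL≤t  = ∃-small-scale 0≤L 0<t
    in  ε , 0<ε , ≤-trans ε≤t t≤b , λ i → ≤-trans εL≤t (t≤Dem i)

  positive⇒assigned : ∀ {x} (a : Fin nD → Fin nF) → IsAssignment I x → (∀ i → x i (a i) ≡ Dem i) →
                      ∀ i j → 0ℚ < x i j → j ≡ a i
  positive⇒assigned {x} a (0≤x , x-rows , _) x-a i j 0<x with j ≟ a i
  ... | yes j≡aᵢ = j≡aᵢ
  ... | no  j≢aᵢ = ⊥-elim (<-irrefl refl (<-≤-trans 0<x xᵢⱼ≤0))
    where
    xᵢⱼ≤0 : x i j ≤ 0ℚ
    xᵢⱼ≤0 = ≤-by-slack (subst₂ (λ d s → x i j + d ≤ s) (x-a i) (x-rows i) (≤-sumF₂ (0≤x i) j≢aᵢ))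
              (solve 2 (λ x d → d :- (x :+ d) := con 0ℚ :- x) refl (x i j) (Dem i))

  module PathBacklogs (a : Fin nD → Fin nF) (x : Assignment I)
                      (x-minCost : IsMinCostAssignment I x) (x-a : ∀ i → x i (a i) ≡ Dem i) where
    open Graph I a
    open Walks a

    private variable
      u v w : Vtx I

    0≤x : ∀ i j → 0ℚ ≤ x i j
    0≤x = proj₁ (proj₁ x-minCost)

    x-rows : ∀ i → sumF (λ j → x i j) ≡ Dem i
    x-rows = proj₁ (proj₂ (proj₁ x-minCost))

    x-caps : ∀ j → load I x j ≤ Cap j
    x-caps = proj₂ (proj₂ (proj₁ x-minCost))

    perturbed : Walk u v → ℚ → Assignment I
    perturbed p ε i j = x i j + ε * flow p i j

    cost-perturbed : (p : Walk u v) (ε : ℚ) → cost I (perturbed p ε) ≡ cost I x + ε * weight p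
    cost-perturbed p ε = trans (cost-+ x (λ i j → ε * flow p i j))
                               (cong (cost I x +_) (trans (cost-*ˡ ε (flow p)) (cong (ε *_) (cost-flow p))))

    perturbed-isAssignment : (p : Walk u v) {ε : ℚ} → 0ℚ ≤ ε →
                             (∀ i → ε * lengthℚ p ≤ Dem i) →
                             (∀ i → demandMass u i ≡ demandMass v i) →
                             (∀ j → ε * (fcMass v j - fcMass u j) ≤ Cap j - load I x j) →
                             IsAssignment I (perturbed p ε)
    perturbed-isAssignment {u} {v} p {ε} 0≤ε εL≤Dem balanced fits = nonNeg , rows , caps
      where
      open ≤-Reasoning
      nonNeg : ∀ i j → 0ℚ ≤ perturbed p ε i j
      nonNeg i j with j ≟ a i
      ... | no j≢aᵢ  = 0≤p+q (0≤x i j) (0≤p*q 0≤ε (0≤flow-≢ p j≢aᵢ))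
      ... | yes refl = begin
        0ℚ                              ≤⟨ p≤q⇒0≤q-p (εL≤Dem i) ⟩
        Dem i - ε * lengthℚ p           ≡⟨ cong₂ _+_ (sym (x-a i)) (neg-distribʳ-* ε (lengthℚ p)) ⟩
        x i (a i) + ε * - lengthℚ p     ≤⟨ +-monoʳ-≤ (x i (a i))
                                             (*-monoˡ-≤-nonNeg ε {{nonNegative 0≤ε}} (-lengthℚ≤flow p i (a i))) ⟩
        x i (a i) + ε * flow p i (a i)  ∎
      rows : ∀ i → sumF (λ j → perturbed p ε i j) ≡ Dem i
      rows i = begin-equality
        sumF (λ j → x i j + ε * flow p i j)  ≡⟨ sumF-+-*ˡ ε (x i) (flow p i) ⟩
        sumF (x i) + ε * sumF (flow p i)     ≡⟨ cong₂ (λ d f → d + ε * f) (x-rows i) flow-rowᵢ ⟩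
        Dem i + ε * 0ℚ                       ≡⟨ trans (cong (Dem i +_) (*-zeroʳ ε)) (+-identityʳ (Dem i)) ⟩
        Dem i                                ∎
        where
        flow-rowᵢ : sumF (flow p i) ≡ 0ℚ
        flow-rowᵢ = trans (sumF-flow p i) (trans (cong (_- demandMass v i) (balanced i)) (+-inverseʳ (demandMass v i)))
      caps : ∀ j → load I (perturbed p ε) j ≤ Cap j
      caps j = begin
        load I (perturbed p ε) j                    ≡⟨ sumF-+-*ˡ ε (λ i → x i j) (λ i → flow p i j) ⟩
        load I x j + ε * load I (flow p) j          ≤⟨ +-monoʳ-≤ (load I x j)
                                                         (*-monoˡ-≤-nonNeg ε {{nonNegative 0≤ε}} (load-flow p j)) ⟩
        load I x j + ε * (fcMass v j - fcMass u j)  ≤⟨ +-monoʳ-≤ (load I x j) (fits j) ⟩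
        load I x j + (Cap j - load I x j)           ≡⟨ solve 2 (λ l c → l :+ (c :- l) := c) refl (load I x j) (Cap j) ⟩
        Cap j                                       ∎

    0≤weight-perturbable : (p : Walk u v) {ε : ℚ} → 0ℚ < ε →
                           (∀ i → ε * lengthℚ p ≤ Dem i) →
                           (∀ i → demandMass u i ≡ demandMass v i) →
                           (∀ j → ε * (fcMass v j - fcMass u j) ≤ Cap j - load I x j) →
                           0ℚ ≤ weight p
    0≤weight-perturbable p {ε} 0<ε εL≤Dem balanced fits = *-cancelˡ-≤-pos ε {{positive 0<ε}} (begin
      ε * 0ℚ                                ≡⟨ *-zeroʳ ε ⟩
      0ℚ                                    ≤⟨ p≤q⇒0≤q-p (proj₂ x-minCost (perturbed p ε) perturbed-asg) ⟩
      cost I (perturbed p ε) - cost I x     ≡⟨ cong (_- cost I x) (cost-perturbed p ε) ⟩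
      (cost I x + ε * weight p) - cost I x  ≡⟨ solve 2 (λ c d → (c :+ d) :- c := d) refl (cost I x) (ε * weight p) ⟩
      ε * weight p                          ∎)
      where
      open ≤-Reasoning
      perturbed-asg = perturbed-isAssignment p (<⇒≤ 0<ε) εL≤Dem balanced fits

    0≤weight-cycle : (c : Walk w w) → 0ℚ ≤ weight c
    0≤weight-cycle {w} c =
      let ε , 0<ε , _ , εL≤Dem = ∃-stepSize (0≤lengthℚ c) (positive⁻¹ 1ℚ)
      in  0≤weight-perturbable c 0<ε εL≤Dem (λ _ → refl) (fits ε)
      where
      fits : ∀ ε j → ε * (fcMass w j - fcMass w j) ≤ Cap j - load I x j
      fits ε j = subst (_≤ Cap j - load I x j) (sym (trans (cong (ε *_) (+-inverseʳ (fcMass w j))) (*-zeroʳ ε)))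
                       (p≤q⇒0≤q-p (x-caps j))

    0≤weight-toSpareFC : ∀ {j₀} → load I x j₀ < Cap j₀ → (p : Walk root (fc j₀)) → 0ℚ ≤ weight p
    0≤weight-toSpareFC {j₀} under p =
      let ε , 0<ε , ε≤spare , εL≤Dem = ∃-stepSize (0≤lengthℚ p) (p<q⇒0<q-p under)
      in  0≤weight-perturbable p 0<ε εL≤Dem (λ _ → refl) (λ j → fits ε≤spare j)
      where
      fits : ∀ {ε} → ε ≤ Cap j₀ - load I x j₀ → ∀ j → ε * (kronecker j₀ j - 0ℚ) ≤ Cap j - load I x j
      fits {ε} ε≤spare j rewrite +-identityʳ (kronecker j₀ j) with j₀ ≟ j
      ... | yes refl = subst (_≤ Cap j - load I x j) (sym (*-identityʳ ε)) ε≤spare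
      ... | no _     = subst (_≤ Cap j - load I x j) (sym (*-zeroʳ ε)) (p≤q⇒0≤q-p (x-caps j))

    lightest : Vtx I → ℚ
    lightest v = weight (lightestCandidate v)

    lightest-≤ : (p : Walk root v) → lightest v ≤ weight p
    lightest-≤ p =
      let q , q-path , q≤p = shortcut 0≤weight-cycle p
      in  ≤-trans (lightestCandidate-≤-path q q-path) q≤p

    lightestPath : ∀ v → Σ (Walk root v) λ q → IsPath q × weight q ≡ lightest v
    lightestPath v =
      let q , q-path , q≤ = shortcut 0≤weight-cycle (lightestCandidate v)
      in  q , q-path , ≤-antisym q≤ (lightest-≤ q)

    lightest-isMinPathWeight : ∀ v → IsMinPathWeight root v (- - lightest v)
    lightest-isMinPathWeight v rewrite ⁻¹-involutive (lightest v) = lightestPath v , λ p _ → lightest-≤ p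

    backlog : Fin nF → ℚ
    backlog j = - lightest (fc j)

    delay : Fin nD → ℚ
    delay i = - lightest (dm i)

    lightest-fc≤0 : ∀ j → lightest (fc j) ≤ 0ℚ
    lightest-fc≤0 j = lightest-≤ (defaultWalk (fc j))

    0≤backlog : ∀ j → 0ℚ ≤ backlog j
    0≤backlog j = neg-antimono-≤ (lightest-fc≤0 j)

    lightest-fc-≤-dm : ∀ {i} (p : Walk root (dm i)) → lightest (fc (a i)) - ℓ I i (a i) ≤ weight p
    lightest-fc-≤-dm (step p (j→i i)) = +-monoˡ-≤ (- ℓ I i (a i)) (lightest-≤ p)

    lightest-dm : ∀ i → lightest (dm i) ≡ lightest (fc (a i)) - ℓ I i (a i)
    lightest-dm i =
      let q , _ , q≡ = lightestPath (fc (a i))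
          r , _ , r≡ = lightestPath (dm i)
      in  ≤-antisym (subst (λ w → lightest (dm i) ≤ w - ℓ I i (a i)) q≡ (lightest-≤ (step q (j→i i))))
                    (subst (lightest (fc (a i)) - ℓ I i (a i) ≤_) r≡ (lightest-fc-≤-dm r))

    assignment-optimal : ∀ i j → ℓ I i (a i) + backlog (a i) ≤ ℓ I i j + backlog j
    assignment-optimal i j with j ≟ a i
    ... | yes refl = ≤-refl
    ... | no j≢aᵢ  =
      let q , _ , q≡ = lightestPath (fc (a i))
          bound : lightest (fc j) ≤ (lightest (fc (a i)) - ℓ I i (a i)) + ℓ I i j
          bound = subst (λ w → lightest (fc j) ≤ (w - ℓ I i (a i)) + ℓ I i j) q≡
                        (lightest-≤ (step (step q (j→i i)) (i→j i j j≢aᵢ)))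
      in  ≤-by-slack bound (solve 4 (λ m l mⱼ lⱼ → ((m :- l) :+ lⱼ) :- mⱼ := (lⱼ :+ :- mⱼ) :- (l :+ :- m)) refl
                              (lightest (fc (a i))) (ℓ I i (a i)) (lightest (fc j)) (ℓ I i j))

    delayOf-backlog : ∀ i → delayOf I backlog i ≡ delay i
    delayOf-backlog i = begin
      delayOf I backlog i                      ≡⟨ minF-attained (a i) (assignment-optimal i) ⟩
      ℓ I i (a i) + backlog (a i)              ≡⟨ solve 2 (λ l m → l :+ :- m := :- (m :- l)) refl
                                                    (ℓ I i (a i)) (lightest (fc (a i))) ⟩
      - (lightest (fc (a i)) - ℓ I i (a i))    ≡⟨ cong -_ (sym (lightest-dm i)) ⟩
      delay i                                  ∎
      where open ≡-Reasoning

    backlog-isEquilibrium : IsEquilibrium I backlog x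
    backlog-isEquilibrium = 0≤backlog , proj₁ x-minCost , optimal , spare⇒0
      where
      optimal : ∀ i j → 0ℚ < x i j → ∀ j′ → ℓ I i j + backlog j ≤ ℓ I i j′ + backlog j′
      optimal i j 0<x with refl ← positive⇒assigned a (proj₁ x-minCost) x-a i j 0<x = assignment-optimal i
      spare⇒0 : ∀ j → load I x j < Cap j → backlog j ≡ 0ℚ
      spare⇒0 j under =
        let q , _ , q≡ = lightestPath (fc j)
        in  cong -_ (≤-antisym (lightest-fc≤0 j) (subst (0ℚ ≤_) q≡ (0≤weight-toSpareFC under q)))

    backlog-least : ∀ {β x′} → IsEquilibrium I β x′ → ∀ j → backlog j ≤ β j
    backlog-least {β} eq@(0≤β , _) j =
      let q , _ , q≡ = lightestPath (fc j)
      in  subst (backlog j ≤_) (⁻¹-involutive (β j))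
                (neg-antimono-≤ (subst (- β j ≤_) q≡ (potential-≤-weight 0≤β a-optimal q)))
      where
      a-optimal : ∀ i j → ℓ I i (a i) + β (a i) ≤ ℓ I i j + β j
      a-optimal i j = ≤-trans (minCost-tight eq x-minCost i (a i) (subst (0ℚ <_) (sym (x-a i)) (Dem-pos i)))
                              (minF-≤ (λ j → ℓ I i j + β j) j)

theorem5 : (I : Instance) (x : Assignment I) (a : Fin (Instance.nD I) → Fin (Instance.nF I)) →
    IsMinCostAssignment I x →
    (∀ i → x i (a i) ≡ Instance.Dem I i) →
    Σ (Fin (Instance.nF I) → ℚ) λ β → Σ (Fin (Instance.nD I) → ℚ) λ δ →
      (∀ j → Graph.IsMinPathWeight I a (root) (fc j) (- β j)) ×
      (∀ i → Graph.IsMinPathWeight I a (root) (dm i) (- δ i)) ×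
      IsMinDelayEquilibrium I β x ×
      (∀ i → delayOf I β i ≡ δ i)
theorem5 I x a x-minCost x-a =
  backlog , delay ,
  lightest-isMinPathWeight ∘ fc ,
  lightest-isMinPathWeight ∘ dm ,
  (backlog-isEquilibrium , λ β x′ eq → totalDelay-mono-≤ I (backlog-least eq)) ,
  delayOf-backlog
  where open PathBacklogs I a x x-minCost x-a
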